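{- Let $\mathcal{H}=(\mathcal{V},\mathcal{E})$ be a connected hypergraph and let $B(\mathcal{H})$ be its set of bridges. If $B(\mathcal{H})$ is a proper subset of $\mathcal{E}$ and the sub-hypergraph $(\mathcal{V},B(\mathcal{H}))$ is connected, then $\lambda^2$ divides $P(\mathcal{H},\lambda)$.
   Context: A hypergraph $\mathcal{H}=(\mathcal{V},\mathcal{E})$ has a finite vertex set $\mathcal{V}$ and a set $\mathcal{E}$ of subsets of $\mathcal{V}$ of size at least 1. For positive integer $\lambda$, a weak proper $\lambda$-colouring is a map $\phi:\mathcal{V}\to\{1,\dots,\lambda\}$ with $|\{\phi(v):v\in e\}|>1$ for every $e\in\mathcal{E}$; $P(\mathcal{H},\lambda)$ is the polynomial counting them. $\mathcal{H}$ is connected if for any two vertices $v_1,v_2$ there are edges $e_0,\dots,e_k$ with $v_1\in e_0$, $v_2\in e_k$ and $e_i\cap e_{i+1}\neq\emptyset$ for $0\le i<k$. For connected $\mathcal{H}$, an edge $e$ is a bridge if $\mathcal{H}-e=(\mathcal{V},\mathcal{E}\setminus\{e\})$ is disconnected. -}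

module Defs where

open import Data.Nat using (ℕ; zero; suc)
open import Data.Integer using (ℤ; +_; _+_; _*_)
open import Data.Fin using (Fin; _≟_)
open import Data.Fin.Subset using (Subset; _∈_; Nonempty)
open import Data.Fin.Subset.Properties using (_∈?_)
open import Data.Fin.Properties using (any?; all?)
open import Data.Vec using (Vec; []; _∷_; lookup)
open import Data.List using (List; [_]; concatMap; map; filter; length; allFin)
open import Data.Product using (∃; _×_; _,_)
open import Function.Definitions using (Injective)
open import Relation.Binary.PropositionalEquality using (_≡_; _≢_)
open import Relation.Nullary using (¬_; Dec; ¬?)
open import Relation.Nullary.Decidable using (_×-dec_)

record Hypergraph (n m : ℕ) : Set where
  field
    E        : Fin m → Subset n
    distinct : Injective _≡_ _≡_ E
    nonempty : ∀ i → Nonempty (E i)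
open Hypergraph public

-- Chains of edges (restricted to edges satisfying S) e₀,…,eₖ with
-- v ∈ e₀, w ∈ eₖ and eⱼ ∩ eⱼ₊₁ ≠ ∅.  The argument of `step` is a vertex
-- u ∈ e₀ which also lies in the first edge of the remaining chain.
data Chain {n m : ℕ} (E : Fin m → Subset n) (S : Fin m → Set) :
           Fin n → Fin n → Set where
  single : ∀ {v w} i → S i → v ∈ E i → w ∈ E i → Chain E S v w
  step   : ∀ {v u w} i → S i → v ∈ E i → u ∈ E i → Chain E S u w → Chain E S v w

ConnectedOn : ∀ {n m} → (Fin m → Subset n) → (Fin m → Set) → Set
ConnectedOn {n} E S = ∀ (v w : Fin n) → Chain E S v w

Connected : ∀ {n m} → Hypergraph n m → Set
Connected H = ConnectedOn (E H) (λ _ → ⊤')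
  where
  open import Data.Unit using () renaming (⊤ to ⊤')

IsBridge : ∀ {n m} → Hypergraph n m → Fin m → Set
IsBridge H i = ¬ ConnectedOn (E H) (λ j → j ≢ i)

Proper : ∀ {n m k} → Hypergraph n m → Vec (Fin k) n → Set
Proper H φ = ∀ i → ∃ λ v → ∃ λ w → v ∈ E H i × w ∈ E H i × lookup φ v ≢ lookup φ w

proper? : ∀ {n m k} (H : Hypergraph n m) (φ : Vec (Fin k) n) → Dec (Proper H φ)
proper? H φ = all? λ i → any? λ v → any? λ w →
  (v ∈? E H i) ×-dec (w ∈? E H i) ×-dec ¬? (lookup φ v ≟ lookup φ w)

allMaps : ∀ n k → List (Vec (Fin k) n)
allMaps zero    k = [ [] ]
allMaps (suc n) k = concatMap (λ c → map (c ∷_) (allMaps n k)) (allFin k)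

chromCount : ∀ {n m} → Hypergraph n m → ℕ → ℕ
chromCount {n} H k = length (filter (proper? H) (allMaps n k))

-- Integer polynomials as coefficient lists (constant term first).
evalPoly : List ℤ → ℤ → ℤ
evalPoly List.[]       x = + 0
evalPoly (c List.∷ cs) x = c + x * evalPoly cs x

-- λ² divides P(H,λ) in ℤ[λ]: P(H,λ) = λ²·Q(λ) for an integer polynomial Q,
-- as functions on positive integers (equivalently, as polynomials).
SquareDividesChrom : ∀ {n m} → Hypergraph n m → Set
SquareDividesChrom H = ∃ λ (Q : List ℤ) → ∀ (k : ℕ) →
  + chromCount H (suc k) ≡ (+ suc k) * (+ suc k) * evalPoly Q (+ suc k)

module Submission where

-- Inclusion–exclusion over the set of monochromatic edges gives
--     P(H,k) = Σ_{S ⊆ E} (-1)^|S| · k^c(S),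
-- where c(S) is the number of components of (V,S).  A colouring is
-- monochromatic on every edge of S iff it satisfies a list of vertex
-- equalities; counting the solutions of such a list by eliminating one
-- vertex at a time gives k^c.  Every c(S) is at least 1, and
--     c(S) ≤ 1  ⟺  S contains every bridge
-- (⇐ because the bridges connect H; ⇒ because a bridge missing from a
-- connecting S would leave H - b connected).  Write each term as a part of
-- degree ≤ 1 plus k²·(polynomial).  Toggling a fixed non-bridge e₀ is a
-- sign-reversing involution on subsets that preserves "contains every
-- bridge", so the parts of degree ≤ 1 cancel and P(H,k) = k²·Q(k).

open import Defs
open import Data.Nat using (ℕ; zero; suc; _≤_; _≤?_; z≤n; s≤s)
import Data.Nat.Properties as ℕP
open import Data.Integer using (ℤ; +_; -_; _+_; _*_; _^_)
import Data.Integer.Properties as ℤP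
open import Data.Integer.Tactic.RingSolver using (solve-∀)
open import Data.Fin using (Fin; zero; suc; _≟_)
open import Data.Fin.Properties using (suc-injective; all?; any?)
open import Data.Fin.Subset using (Subset; _∈_)
open import Data.Fin.Subset.Properties using (_∈?_)
open import Data.Vec using (Vec; []; _∷_; lookup; tabulate; replicate)
open import Data.Vec.Properties using (lookup∘tabulate; lookup-replicate)
open import Data.List as List using (List; []; _∷_; _++_; map; concatMap; filter; length; allFin)
open import Data.List.Relation.Unary.All as All using (All; []; _∷_)
import Data.List.Relation.Unary.All.Properties as AllP
open import Data.List.Relation.Unary.Any using (here; there)
open import Data.List.Membership.Propositional using () renaming (_∈_ to _∈ₗ_)
open import Data.List.Membership.Propositional.Properties using (∈-allFin)
open import Data.Bool using (Bool; true; false; not; if_then_else_)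
open import Data.Maybe using (Maybe; just; nothing)
open import Data.Product using (∃; Σ; _×_; _,_; proj₁; proj₂)
open import Data.Sum using (_⊎_; inj₁; inj₂)
open import Data.Empty using (⊥; ⊥-elim)
open import Relation.Nullary using (¬_; Dec; yes; no; ¬?)
open import Relation.Nullary.Decidable using (_×-dec_; _⊎-dec_; ¬¬-excluded-middle)
open import Relation.Binary.PropositionalEquality
open import Function using (_∘_)

ind : {A : Set} → Dec A → ℤ
ind (yes _) = + 1
ind (no _)  = + 0

ind-yes : {A : Set} → A → (d : Dec A) → ind d ≡ + 1
ind-yes a (yes _) = refl
ind-yes a (no ¬a) = ⊥-elim (¬a a)

ind-no : {A : Set} → ¬ A → (d : Dec A) → ind d ≡ + 0
ind-no ¬a (yes a) = ⊥-elim (¬a a)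
ind-no ¬a (no _)  = refl

ind-⇔ : {A B : Set} (d : Dec A) (e : Dec B) → (A → B) → (B → A) → ind d ≡ ind e
ind-⇔ d (yes b) f g = ind-yes (g b) d
ind-⇔ d (no ¬b) f g = ind-no (¬b ∘ f) d

ind-× : {A B C : Set} (d : Dec C) (e : Dec A) (f : Dec B) →
        (C → A × B) → (A → B → C) → ind d ≡ ind e * ind f
ind-× d (yes a) (yes b) g h = ind-yes (h a b) d
ind-× d (yes a) (no ¬b) g h = ind-no (¬b ∘ proj₂ ∘ g) d
ind-× d (no ¬a) (yes b) g h = ind-no (¬a ∘ proj₁ ∘ g) d
ind-× d (no ¬a) (no ¬b) g h = ind-no (¬a ∘ proj₁ ∘ g) d

ind-¬ : {A B : Set} (d : Dec A) (e : Dec B) → (A → ¬ B) → (¬ B → A) → ind d ≡ + 1 + - ind e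
ind-¬ d (yes b) f g = ind-no (λ a → f a b) d
ind-¬ d (no ¬b) f g = ind-yes (g ¬b) d

sumL : {A : Set} → List A → (A → ℤ) → ℤ
sumL []       f = + 0
sumL (x ∷ xs) f = f x + sumL xs f

sumL-cong : {A : Set} (xs : List A) {f g : A → ℤ} → (∀ x → f x ≡ g x) → sumL xs f ≡ sumL xs g
sumL-cong []       h = refl
sumL-cong (x ∷ xs) h = cong₂ _+_ (h x) (sumL-cong xs h)

sumL-zero : {A : Set} (xs : List A) → sumL xs (λ _ → + 0) ≡ + 0
sumL-zero []       = refl
sumL-zero (x ∷ xs) = trans (ℤP.+-identityˡ _) (sumL-zero xs)

sumL-+ : {A : Set} (xs : List A) (f g : A → ℤ) → sumL xs (λ x → f x + g x) ≡ sumL xs f + sumL xs g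
sumL-+ []       f g = refl
sumL-+ (x ∷ xs) f g = trans (cong (_+_ (f x + g x)) (sumL-+ xs f g)) (interchange (f x) (g x) _ _)
  where
  interchange : ∀ a b c d → a + b + (c + d) ≡ a + c + (b + d)
  interchange = solve-∀

sumL-*ˡ : {A : Set} (xs : List A) (a : ℤ) (f : A → ℤ) → sumL xs (λ x → a * f x) ≡ a * sumL xs f
sumL-*ˡ []       a f = sym (ℤP.*-zeroʳ a)
sumL-*ˡ (x ∷ xs) a f = trans (cong (_+_ (a * f x)) (sumL-*ˡ xs a f)) (sym (ℤP.*-distribˡ-+ a (f x) _))

sumL-swap : {A B : Set} (xs : List A) (ys : List B) (f : A → B → ℤ) →
  sumL xs (λ x → sumL ys (f x)) ≡ sumL ys (λ y → sumL xs (λ x → f x y))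
sumL-swap []       ys f = sym (sumL-zero ys)
sumL-swap (x ∷ xs) ys f = trans (cong (_+_ (sumL ys (f x))) (sumL-swap xs ys f)) (sym (sumL-+ ys (f x) _))

sumL-++ : {A : Set} (xs ys : List A) (f : A → ℤ) → sumL (xs ++ ys) f ≡ sumL xs f + sumL ys f
sumL-++ []       ys f = sym (ℤP.+-identityˡ _)
sumL-++ (x ∷ xs) ys f = trans (cong (_+_ (f x)) (sumL-++ xs ys f)) (sym (ℤP.+-assoc (f x) _ _))

sumL-map : {A B : Set} (g : A → B) (xs : List A) (f : B → ℤ) → sumL (map g xs) f ≡ sumL xs (f ∘ g)
sumL-map g []       f = refl
sumL-map g (x ∷ xs) f = cong (_+_ (f (g x))) (sumL-map g xs f)

sumL-concatMap : {A B : Set} (g : A → List B) (xs : List A) (f : B → ℤ) →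
  sumL (concatMap g xs) f ≡ sumL xs (λ x → sumL (g x) f)
sumL-concatMap g []       f = refl
sumL-concatMap g (x ∷ xs) f =
  trans (sumL-++ (g x) (concatMap g xs) f) (cong (_+_ (sumL (g x) f)) (sumL-concatMap g xs f))

length-filter : {A : Set} {P : A → Set} (P? : ∀ x → Dec (P x)) (xs : List A) →
  + length (filter P? xs) ≡ sumL xs (ind ∘ P?)
length-filter P? [] = refl
length-filter P? (x ∷ xs) with P? x
... | yes _ = cong (_+_ (+ 1)) (length-filter P? xs)
... | no _  = trans (length-filter P? xs) (sym (ℤP.+-identityˡ _))

sumF : ∀ n → (Fin n → ℤ) → ℤ
sumF zero    f = + 0
sumF (suc n) f = f zero + sumF n (f ∘ suc)

prodF : ∀ n → (Fin n → ℤ) → ℤ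
prodF zero    f = + 1
prodF (suc n) f = f zero * prodF n (f ∘ suc)

sumF-cong : ∀ n {f g : Fin n → ℤ} → (∀ x → f x ≡ g x) → sumF n f ≡ sumF n g
sumF-cong zero    h = refl
sumF-cong (suc n) h = cong₂ _+_ (h zero) (sumF-cong n (h ∘ suc))

sumF-zero : ∀ n → sumF n (λ _ → + 0) ≡ + 0
sumF-zero zero    = refl
sumF-zero (suc n) = trans (ℤP.+-identityˡ _) (sumF-zero n)

sumF-const : ∀ n a → sumF n (λ _ → a) ≡ + n * a
sumF-const zero    a = sym (ℤP.*-zeroˡ a)
sumF-const (suc n) a = trans (cong (_+_ a) (sumF-const n a)) (expand a (+ n))
  where
  expand : ∀ a b → a + b * a ≡ (+ 1 + b) * a
  expand = solve-∀

sumF-*ʳ : ∀ n (f : Fin n → ℤ) a → sumF n (λ c → f c * a) ≡ sumF n f * a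
sumF-*ʳ zero    f a = sym (ℤP.*-zeroˡ a)
sumF-*ʳ (suc n) f a = trans (cong (_+_ (f zero * a)) (sumF-*ʳ n (f ∘ suc) a)) (sym (ℤP.*-distribʳ-+ a (f zero) _))

sumF-delta : ∀ n (x : Fin n) → sumF n (λ c → ind (c ≟ x)) ≡ + 1
sumF-delta (suc n) zero =
  cong (_+_ (+ 1))
            (trans (sumF-cong n (λ c → ind-no (λ ()) (suc c ≟ zero))) (sumF-zero n))
sumF-delta (suc n) (suc x) =
  cong (_+_ (+ 0))
            (trans (sumF-cong n (λ c → ind-⇔ (suc c ≟ suc x) (c ≟ x) suc-injective (cong suc)))
                   (sumF-delta n x))

sumL-tabulate : {A : Set} (n : ℕ) (g : Fin n → A) (f : A → ℤ) → sumL (List.tabulate g) f ≡ sumF n (f ∘ g)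
sumL-tabulate zero    g f = refl
sumL-tabulate (suc n) g f = cong (_+_ (f (g zero))) (sumL-tabulate n (g ∘ suc) f)

sumF-swap : {A : Set} (n : ℕ) (xs : List A) (f : Fin n → A → ℤ) →
  sumF n (λ c → sumL xs (f c)) ≡ sumL xs (λ x → sumF n (λ c → f c x))
sumF-swap n xs f = begin
  sumF n (λ c → sumL xs (f c))                  ≡⟨ sym (sumL-tabulate n (λ c → c) _) ⟩
  sumL (allFin n) (λ c → sumL xs (f c))          ≡⟨ sumL-swap (allFin n) xs f ⟩
  sumL xs (λ x → sumL (allFin n) (λ c → f c x))  ≡⟨ sumL-cong xs (λ x → sumL-tabulate n (λ c → c) _) ⟩
  sumL xs (λ x → sumF n (λ c → f c x))           ∎
  where open ≡-Reasoning

prodF-cong : ∀ n {f g : Fin n → ℤ} → (∀ x → f x ≡ g x) → prodF n f ≡ prodF n g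
prodF-cong zero    h = refl
prodF-cong (suc n) h = cong₂ _*_ (h zero) (prodF-cong n (h ∘ suc))

prodF-* : ∀ n (f g : Fin n → ℤ) → prodF n (λ i → f i * g i) ≡ prodF n f * prodF n g
prodF-* zero    f g = refl
prodF-* (suc n) f g = trans (cong (_*_ (f zero * g zero)) (prodF-* n (f ∘ suc) (g ∘ suc))) (interchange (f zero) (g zero) _ _)
  where
  interchange : ∀ a b c d → a * b * (c * d) ≡ a * c * (b * d)
  interchange = solve-∀

-- Σ over all subsets S of Fin m, represented as Boolean vectors
-- (i ∈ S iff lookup S i ≡ true).
sumB : ∀ m → (Vec Bool m → ℤ) → ℤ
sumB zero    F = F []
sumB (suc m) F = sumB m (F ∘ (true ∷_)) + sumB m (F ∘ (false ∷_))

sumB-cong : ∀ m {F G : Vec Bool m → ℤ} → (∀ S → F S ≡ G S) → sumB m F ≡ sumB m G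
sumB-cong zero    h = h []
sumB-cong (suc m) h = cong₂ _+_ (sumB-cong m (h ∘ (true ∷_))) (sumB-cong m (h ∘ (false ∷_)))

sumB-+ : ∀ m (F G : Vec Bool m → ℤ) → sumB m (λ S → F S + G S) ≡ sumB m F + sumB m G
sumB-+ zero    F G = refl
sumB-+ (suc m) F G =
  trans (cong₂ _+_ (sumB-+ m (F ∘ (true ∷_)) (G ∘ (true ∷_))) (sumB-+ m (F ∘ (false ∷_)) (G ∘ (false ∷_))))
        (interchange (sumB m (F ∘ (true ∷_))) (sumB m (G ∘ (true ∷_)))
                     (sumB m (F ∘ (false ∷_))) (sumB m (G ∘ (false ∷_))))
  where
  interchange : ∀ a b c d → a + b + (c + d) ≡ a + c + (b + d)
  interchange = solve-∀

sumB-*ˡ : ∀ m a (F : Vec Bool m → ℤ) → sumB m (λ S → a * F S) ≡ a * sumB m F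
sumB-*ˡ zero    a F = refl
sumB-*ˡ (suc m) a F = trans (cong₂ _+_ (sumB-*ˡ m a _) (sumB-*ˡ m a _)) (sym (ℤP.*-distribˡ-+ a _ _))

sumB-neg : ∀ m (F : Vec Bool m → ℤ) → sumB m (λ S → - F S) ≡ - sumB m F
sumB-neg zero    F = refl
sumB-neg (suc m) F =
  trans (cong₂ _+_ (sumB-neg m (F ∘ (true ∷_))) (sumB-neg m (F ∘ (false ∷_))))
        (sym (ℤP.neg-distrib-+ (sumB m (F ∘ (true ∷_))) (sumB m (F ∘ (false ∷_)))))

sumL-sumB : {A : Set} (xs : List A) (m : ℕ) (F : A → Vec Bool m → ℤ) →
  sumL xs (λ x → sumB m (F x)) ≡ sumB m (λ S → sumL xs (λ x → F x S))
sumL-sumB xs zero    F = refl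
sumL-sumB xs (suc m) F = trans (sumL-+ xs _ _) (cong₂ _+_ (sumL-sumB xs m _) (sumL-sumB xs m _))

expand-product : ∀ m (g : Fin m → Bool → ℤ) →
  sumB m (λ S → prodF m (λ i → g i (lookup S i))) ≡ prodF m (λ i → g i true + g i false)
expand-product zero    g = refl
expand-product (suc m) g =
  trans (cong₂ _+_ (sumB-*ˡ m (g zero true) _) (sumB-*ˡ m (g zero false) _))
        (trans (sym (ℤP.*-distribʳ-+ _ (g zero true) (g zero false)))
               (cong ((g zero true + g zero false) *_) (expand-product m (g ∘ suc))))

toggle : ∀ {m} → Fin m → Vec Bool m → Vec Bool m
toggle zero    (b ∷ S) = not b ∷ S
toggle (suc i) (b ∷ S) = b ∷ toggle i S

lookup-toggle : ∀ {m} (e j : Fin m) (S : Vec Bool m) → j ≢ e → lookup (toggle e S) j ≡ lookup S j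
lookup-toggle zero    zero    (b ∷ S) j≢e = ⊥-elim (j≢e refl)
lookup-toggle zero    (suc j) (b ∷ S) j≢e = refl
lookup-toggle (suc e) zero    (b ∷ S) j≢e = refl
lookup-toggle (suc e) (suc j) (b ∷ S) j≢e = lookup-toggle e j S (j≢e ∘ cong suc)

sumB-toggle : ∀ m (e : Fin m) (F : Vec Bool m → ℤ) → (∀ S → F (toggle e S) ≡ - F S) → sumB m F ≡ + 0
sumB-toggle (suc m) zero F odd =
  trans (cong (_+_ (sumB m (F ∘ (true ∷_)))) (trans (sumB-cong m (odd ∘ (true ∷_))) (sumB-neg m _)))
        (ℤP.+-inverseʳ (sumB m (F ∘ (true ∷_))))
sumB-toggle (suc m) (suc e) F odd =
  cong₂ _+_ (sumB-toggle m e _ (odd ∘ (true ∷_))) (sumB-toggle m e _ (odd ∘ (false ∷_)))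

sgnᵇ : Bool → ℤ
sgnᵇ true  = - + 1
sgnᵇ false = + 1

sgn : ∀ {m} → Vec Bool m → ℤ
sgn {m} S = prodF m (λ i → sgnᵇ (lookup S i))

sgn-toggle : ∀ {m} (e : Fin m) S → sgn (toggle e S) ≡ - sgn S
sgn-toggle zero (true ∷ S) = flip (sgn S)
  where
  flip : ∀ a → + 1 * a ≡ - (- + 1 * a)
  flip = solve-∀
sgn-toggle zero (false ∷ S) = flip (sgn S)
  where
  flip : ∀ a → - + 1 * a ≡ - (+ 1 * a)
  flip = solve-∀
sgn-toggle (suc e) (b ∷ S) = trans (cong (sgnᵇ b *_) (sgn-toggle e S)) (sym (ℤP.neg-distribʳ-* (sgnᵇ b) (sgn S)))

addP : List ℤ → List ℤ → List ℤ
addP []      q       = q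
addP (a ∷ p) []      = a ∷ p
addP (a ∷ p) (b ∷ q) = (a + b) ∷ addP p q

eval-addP : ∀ p q x → evalPoly (addP p q) x ≡ evalPoly p x + evalPoly q x
eval-addP []      q       x = sym (ℤP.+-identityˡ _)
eval-addP (a ∷ p) []      x = sym (ℤP.+-identityʳ _)
eval-addP (a ∷ p) (b ∷ q) x = trans (cong (λ t → a + b + x * t) (eval-addP p q x)) (regroup a b x _ _)
  where
  regroup : ∀ a b x c d → a + b + x * (c + d) ≡ a + x * c + (b + x * d)
  regroup = solve-∀

monomial : ℤ → ℕ → List ℤ
monomial s zero    = s ∷ []
monomial s (suc j) = + 0 ∷ monomial s j

eval-monomial : ∀ s j x → evalPoly (monomial s j) x ≡ s * x ^ j
eval-monomial s zero    x = constant s x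
  where
  constant : ∀ s x → s + x * + 0 ≡ s * + 1
  constant = solve-∀
eval-monomial s (suc j) x = trans (cong (λ t → + 0 + x * t) (eval-monomial s j x)) (shift s x (x ^ j))
  where
  shift : ∀ s x y → + 0 + x * (s * y) ≡ s * (x * y)
  shift = solve-∀

sumPolyB : ∀ m → (Vec Bool m → List ℤ) → List ℤ
sumPolyB zero    F = F []
sumPolyB (suc m) F = addP (sumPolyB m (F ∘ (true ∷_))) (sumPolyB m (F ∘ (false ∷_)))

eval-sumPolyB : ∀ m F x → evalPoly (sumPolyB m F) x ≡ sumB m (λ S → evalPoly (F S) x)
eval-sumPolyB zero    F x = refl
eval-sumPolyB (suc m) F x =
  trans (eval-addP (sumPolyB m (F ∘ (true ∷_))) (sumPolyB m (F ∘ (false ∷_))) x)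
        (cong₂ _+_ (eval-sumPolyB m (F ∘ (true ∷_)) x) (eval-sumPolyB m (F ∘ (false ∷_)) x))

-- A constraint (v , w) asks a colouring to give v and w the same colour.
Constraint : ℕ → Set
Constraint n = Fin n × Fin n

Sat : ∀ {n k} → Vec (Fin k) n → List (Constraint n) → Set
Sat φ L = All (λ p → lookup φ (proj₁ p) ≡ lookup φ (proj₂ p)) L

sat? : ∀ {n k} (φ : Vec (Fin k) n) (L : List (Constraint n)) → Dec (Sat φ L)
sat? φ L = All.all? (λ p → lookup φ (proj₁ p) ≟ lookup φ (proj₂ p)) L

-- Classes are counted by eliminating vertex 0: if some constraint ties it to
-- a vertex suc u (its partner), 0 is merged into u; otherwise 0 is a class
-- of its own and its (trivial) constraints are dropped.
partner : ∀ {n} → List (Constraint (suc n)) → Maybe (Fin n)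
partner []                    = nothing
partner ((zero  , zero)  ∷ L) = partner L
partner ((zero  , suc u) ∷ L) = just u
partner ((suc u , zero)  ∷ L) = just u
partner ((suc a , suc b) ∷ L) = partner L

merge : ∀ {n} → Fin n → Fin (suc n) → Fin n
merge u zero    = u
merge u (suc x) = x

mergeL : ∀ {n} → Fin n → List (Constraint (suc n)) → List (Constraint n)
mergeL u = map (λ p → merge u (proj₁ p) , merge u (proj₂ p))

dropL : ∀ {n} → List (Constraint (suc n)) → List (Constraint n)
dropL []                    = []
dropL ((zero  , zero)  ∷ L) = dropL L
dropL ((zero  , suc u) ∷ L) = dropL L
dropL ((suc u , zero)  ∷ L) = dropL L
dropL ((suc a , suc b) ∷ L) = (a , b) ∷ dropL L

classes : ∀ n → List (Constraint n) → ℕ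
classes zero    L = 0
classes (suc n) L with partner L
... | just u  = classes n (mergeL u L)
... | nothing = suc (classes n (dropL L))

classes-pos : ∀ n (L : List (Constraint (suc n))) → 1 ≤ classes (suc n) L
classes-pos n L with partner L
classes-pos zero    L | just ()
classes-pos (suc n) L | just u  = classes-pos n (mergeL u L)
... | nothing = s≤s z≤n

partner-forced : ∀ {n k} (L : List (Constraint (suc n))) {u} {c : Fin k} {ψ} →
  partner L ≡ just u → Sat (c ∷ ψ) L → c ≡ lookup ψ u
partner-forced ((zero  , zero)  ∷ L) eq (_ ∷ s) = partner-forced L eq s
partner-forced ((zero  , suc u) ∷ L) refl (h ∷ s) = h
partner-forced ((suc u , zero)  ∷ L) refl (h ∷ s) = sym h
partner-forced ((suc a , suc b) ∷ L) eq (_ ∷ s) = partner-forced L eq s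

lookup-merge : ∀ {n k} {u : Fin n} {c : Fin k} {ψ} → c ≡ lookup ψ u →
  ∀ a → lookup (c ∷ ψ) a ≡ lookup ψ (merge u a)
lookup-merge c≡ψu zero    = c≡ψu
lookup-merge c≡ψu (suc a) = refl

merge-sat→ : ∀ {n k} (L : List (Constraint (suc n))) {u} {c : Fin k} {ψ} →
  c ≡ lookup ψ u → Sat (c ∷ ψ) L → Sat ψ (mergeL u L)
merge-sat→ []            e []      = []
merge-sat→ ((a , b) ∷ L) e (h ∷ s) =
  trans (sym (lookup-merge e a)) (trans h (lookup-merge e b)) ∷ merge-sat→ L e s

merge-sat← : ∀ {n k} (L : List (Constraint (suc n))) {u} {c : Fin k} {ψ} →
  c ≡ lookup ψ u → Sat ψ (mergeL u L) → Sat (c ∷ ψ) L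
merge-sat← []            e []      = []
merge-sat← ((a , b) ∷ L) e (h ∷ s) =
  trans (lookup-merge e a) (trans h (sym (lookup-merge e b))) ∷ merge-sat← L e s

drop-sat→ : ∀ {n k} (L : List (Constraint (suc n))) {c : Fin k} {ψ} →
  partner L ≡ nothing → Sat (c ∷ ψ) L → Sat ψ (dropL L)
drop-sat→ []                    eq s       = []
drop-sat→ ((zero  , zero)  ∷ L) eq (_ ∷ s) = drop-sat→ L eq s
drop-sat→ ((suc a , suc b) ∷ L) eq (h ∷ s) = h ∷ drop-sat→ L eq s

drop-sat← : ∀ {n k} (L : List (Constraint (suc n))) {c : Fin k} {ψ} →
  partner L ≡ nothing → Sat ψ (dropL L) → Sat (c ∷ ψ) L
drop-sat← []                    eq s       = []
drop-sat← ((zero  , zero)  ∷ L) eq s       = refl ∷ drop-sat← L eq s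
drop-sat← ((suc a , suc b) ∷ L) eq (h ∷ s) = h ∷ drop-sat← L eq s

sum-allMaps : ∀ n k (f : Vec (Fin k) (suc n) → ℤ) →
  sumL (allMaps (suc n) k) f ≡ sumF k (λ c → sumL (allMaps n k) (λ ψ → f (c ∷ ψ)))
sum-allMaps n k f =
  trans (sumL-concatMap (λ c → map (c ∷_) (allMaps n k)) (allFin k) f)
        (trans (sumL-tabulate k (λ c → c) _) (sumF-cong k (λ c → sumL-map (c ∷_) (allMaps n k) f)))

count-solutions : ∀ n k L → sumL (allMaps n k) (λ φ → ind (sat? φ L)) ≡ (+ k) ^ classes n L
count-solutions zero    k []            = refl
count-solutions zero    k ((() , _) ∷ L)
count-solutions (suc n) k L with partner L in eq
... | just u = begin
    sumL (allMaps (suc n) k) (λ φ → ind (sat? φ L))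
      ≡⟨ sum-allMaps n k _ ⟩
    sumF k (λ c → sumL (allMaps n k) (λ ψ → ind (sat? (c ∷ ψ) L)))
      ≡⟨ sumF-cong k (λ c → sumL-cong (allMaps n k) (split c)) ⟩
    sumF k (λ c → sumL (allMaps n k) (λ ψ → ind (c ≟ lookup ψ u) * ind (sat? ψ L′)))
      ≡⟨ sumF-swap k (allMaps n k) _ ⟩
    sumL (allMaps n k) (λ ψ → sumF k (λ c → ind (c ≟ lookup ψ u) * ind (sat? ψ L′)))
      ≡⟨ sumL-cong (allMaps n k) pick ⟩
    sumL (allMaps n k) (λ ψ → ind (sat? ψ L′))
      ≡⟨ count-solutions n k L′ ⟩
    (+ k) ^ classes n L′ ∎
  where
  open ≡-Reasoning
  L′ = mergeL u L
  split : ∀ c ψ → ind (sat? (c ∷ ψ) L) ≡ ind (c ≟ lookup ψ u) * ind (sat? ψ L′)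
  split c ψ = ind-× (sat? (c ∷ ψ) L) (c ≟ lookup ψ u) (sat? ψ L′)
    (λ s → partner-forced L eq s , merge-sat→ L (partner-forced L eq s) s)
    (merge-sat← L)
  pick : ∀ ψ → sumF k (λ c → ind (c ≟ lookup ψ u) * ind (sat? ψ L′)) ≡ ind (sat? ψ L′)
  pick ψ = trans (sumF-*ʳ k _ _)
                 (trans (cong (_* ind (sat? ψ L′)) (sumF-delta k (lookup ψ u))) (ℤP.*-identityˡ _))
... | nothing = begin
    sumL (allMaps (suc n) k) (λ φ → ind (sat? φ L))
      ≡⟨ sum-allMaps n k _ ⟩
    sumF k (λ c → sumL (allMaps n k) (λ ψ → ind (sat? (c ∷ ψ) L)))
      ≡⟨ sumF-cong k (λ c → sumL-cong (allMaps n k) (λ ψ →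
           ind-⇔ (sat? (c ∷ ψ) L) (sat? ψ (dropL L)) (drop-sat→ L eq) (drop-sat← L eq))) ⟩
    sumF k (λ c → sumL (allMaps n k) (λ ψ → ind (sat? ψ (dropL L))))
      ≡⟨ sumF-const k _ ⟩
    + k * sumL (allMaps n k) (λ ψ → ind (sat? ψ (dropL L)))
      ≡⟨ cong (+ k *_) (count-solutions n k (dropL L)) ⟩
    + k * (+ k) ^ classes n (dropL L) ∎
  where open ≡-Reasoning

NonConstant : ∀ {n k} → Vec (Fin k) n → Set
NonConstant φ = ∃ λ v → ∃ λ w → lookup φ v ≢ lookup φ w

sat-constant : ∀ {n k} (x : Fin k) (L : List (Constraint n)) → Sat (replicate n x) L
sat-constant x []            = []
sat-constant x ((a , b) ∷ L) = trans (lookup-replicate a x) (sym (lookup-replicate b x)) ∷ sat-constant x L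

two-classes⇒nonconstant : ∀ n (L : List (Constraint n)) → 2 ≤ classes n L →
  Σ (Vec (Fin 2) n) λ φ → Sat φ L × NonConstant φ
two-classes⇒nonconstant (suc n) L le with partner L in eq
... | just u with two-classes⇒nonconstant n (mergeL u L) le
...   | ψ , s , v , w , ψv≢ψw = (lookup ψ u ∷ ψ) , merge-sat← L refl s , suc v , suc w , ψv≢ψw
two-classes⇒nonconstant (suc zero) L (s≤s ()) | nothing
two-classes⇒nonconstant (suc (suc n)) L le | nothing =
  (suc zero ∷ replicate (suc n) zero) , drop-sat← L eq (sat-constant zero (dropL L)) , zero , suc zero , λ ()

one-class⇒constant : ∀ n (L : List (Constraint n)) → classes n L ≤ 1 →
  ∀ {k} (φ : Vec (Fin k) n) → Sat φ L → ∀ v w → lookup φ v ≡ lookup φ w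
one-class⇒constant (suc n) L le (c ∷ ψ) s v w with partner L in eq
... | just u = constant v w
  where
  c≡ψu : c ≡ lookup ψ u
  c≡ψu = partner-forced L eq s
  ψ-constant : ∀ v w → lookup ψ v ≡ lookup ψ w
  ψ-constant = one-class⇒constant n (mergeL u L) le ψ (merge-sat→ L c≡ψu s)
  constant : ∀ v w → lookup (c ∷ ψ) v ≡ lookup (c ∷ ψ) w
  constant zero    zero    = refl
  constant zero    (suc w) = trans c≡ψu (ψ-constant u w)
  constant (suc v) zero    = sym (trans c≡ψu (ψ-constant u v))
  constant (suc v) (suc w) = ψ-constant v w
one-class⇒constant (suc zero) L le (c ∷ []) s zero zero | nothing = refl
one-class⇒constant (suc (suc n)) L (s≤s le) (c ∷ ψ) s v w | nothing =
  ⊥-elim (ℕP.<⇒≱ (classes-pos n (dropL L)) le)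

ind-all : ∀ m {P : Fin m → Set} (P? : ∀ i → Dec (P i)) (d : Dec (∀ i → P i)) →
  ind d ≡ prodF m (ind ∘ P?)
ind-all zero    P? d = ind-yes (λ ()) d
ind-all (suc m) P? d =
  trans (ind-× d (P? zero) (all? (P? ∘ suc)) (λ f → f zero , f ∘ suc) (λ p f → λ { zero → p ; (suc i) → f i }))
        (cong (_*_ (ind (P? zero))) (ind-all m (P? ∘ suc) (all? (P? ∘ suc))))

filter-all⁻ : {A : Set} {Q P : A → Set} (Q? : ∀ x → Dec (Q x)) (xs : List A) →
  All P (filter Q? xs) → ∀ {w} → w ∈ₗ xs → Q w → P w
filter-all⁻ Q? (x ∷ xs) a (here refl) q with Q? x
... | yes _ = All.head a
... | no ¬q = ⊥-elim (¬q q)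
filter-all⁻ Q? (x ∷ xs) a (there w∈xs) q with Q? x
... | yes _ = filter-all⁻ Q? xs (All.tail a) w∈xs q
... | no _  = filter-all⁻ Q? xs a w∈xs q

filter-all⁺ : {A : Set} {Q P : A → Set} (Q? : ∀ x → Dec (Q x)) (xs : List A) →
  (∀ w → Q w → P w) → All P (filter Q? xs)
filter-all⁺ Q? []       h = []
filter-all⁺ Q? (x ∷ xs) h with Q? x
... | yes q = h x q ∷ filter-all⁺ Q? xs h
... | no _  = filter-all⁺ Q? xs h

module EdgeConstraints {n m : ℕ} (H : Hypergraph n m) where

  anchor : Fin m → Fin n
  anchor i = proj₁ (nonempty H i)

  anchor∈ : ∀ i → anchor i ∈ E H i
  anchor∈ i = proj₂ (nonempty H i)

  -- Edge i is monochromatic iff every vertex of it has the anchor's colour.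
  edgeConstraints : Fin m → List (Constraint n)
  edgeConstraints i = map (anchor i ,_) (filter (_∈? E H i) (allFin n))

  mono-elim : ∀ {k} (φ : Vec (Fin k) n) i → Sat φ (edgeConstraints i) →
    ∀ {w} → w ∈ E H i → lookup φ (anchor i) ≡ lookup φ w
  mono-elim φ i s {w} w∈ = filter-all⁻ (_∈? E H i) (allFin n) (AllP.map⁻ s) (∈-allFin w) w∈

  mono-intro : ∀ {k} (φ : Vec (Fin k) n) i →
    (∀ w → w ∈ E H i → lookup φ (anchor i) ≡ lookup φ w) → Sat φ (edgeConstraints i)
  mono-intro φ i h = AllP.map⁺ (filter-all⁺ (_∈? E H i) (allFin n) h)

  mono-eq : ∀ {k} (φ : Vec (Fin k) n) i → Sat φ (edgeConstraints i) →
    ∀ {x y} → x ∈ E H i → y ∈ E H i → lookup φ x ≡ lookup φ y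
  mono-eq φ i s x∈ y∈ = trans (sym (mono-elim φ i s x∈)) (mono-elim φ i s y∈)

  proper-ind : ∀ {k} (φ : Vec (Fin k) n) →
    ind (proper? H φ) ≡ prodF m (λ i → + 1 + - ind (sat? φ (edgeConstraints i)))
  proper-ind φ = trans (ind-all m bichromatic? (proper? H φ)) (prodF-cong m λ i →
      ind-¬ (bichromatic? i) (sat? φ (edgeConstraints i))
        (λ { (v , w , v∈ , w∈ , φv≢φw) s → φv≢φw (mono-eq φ i s v∈ w∈) })
        (not-mono⇒bichromatic i))
    where
    bichromatic? = λ i → any? λ v → any? λ w →
      (v ∈? E H i) ×-dec (w ∈? E H i) ×-dec ¬? (lookup φ v ≟ lookup φ w)
    not-mono⇒bichromatic : ∀ i → ¬ Sat φ (edgeConstraints i) →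
      ∃ λ v → ∃ λ w → v ∈ E H i × w ∈ E H i × lookup φ v ≢ lookup φ w
    not-mono⇒bichromatic i ¬s with bichromatic? i
    ... | yes b = b
    ... | no ¬b = ⊥-elim (¬s (mono-intro φ i same))
      where
      same : ∀ w → w ∈ E H i → lookup φ (anchor i) ≡ lookup φ w
      same w w∈ with lookup φ (anchor i) ≟ lookup φ w
      ... | yes e = e
      ... | no ne = ⊥-elim (¬b (anchor i , w , anchor∈ i , w∈ , ne))

open EdgeConstraints using (edgeConstraints; anchor; anchor∈; mono-eq; mono-intro; proper-ind)

constraintsOf : ∀ {m n} → Vec Bool m → (Fin m → List (Constraint n)) → List (Constraint n)
constraintsOf []      p = []
constraintsOf (b ∷ S) p = (if b then p zero else []) ++ constraintsOf S (p ∘ suc)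

select : Bool → ℤ → ℤ
select true  a = a
select false a = + 1

constraintsOf-ind : ∀ {m n k} (S : Vec Bool m) (p : Fin m → List (Constraint n)) (φ : Vec (Fin k) n) →
  prodF m (λ i → select (lookup S i) (ind (sat? φ (p i)))) ≡ ind (sat? φ (constraintsOf S p))
constraintsOf-ind []      p φ = refl
constraintsOf-ind (b ∷ S) p φ =
  trans (cong₂ _*_ (head b) (constraintsOf-ind S (p ∘ suc) φ))
        (sym (ind-× (sat? φ (constraintsOf (b ∷ S) p)) (sat? φ X) (sat? φ (constraintsOf S (p ∘ suc)))
                    (AllP.++⁻ X) AllP.++⁺))
  where
  X = if b then p zero else []
  head : ∀ b → select b (ind (sat? φ (p zero))) ≡ ind (sat? φ (if b then p zero else []))
  head true  = refl
  head false = refl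

constraintsOf-elim : ∀ {m n k} (S : Vec Bool m) (p : Fin m → List (Constraint n)) (φ : Vec (Fin k) n) →
  Sat φ (constraintsOf S p) → ∀ i → lookup S i ≡ true → Sat φ (p i)
constraintsOf-elim (true ∷ S) p φ s zero    refl = AllP.++⁻ˡ (p zero) s
constraintsOf-elim (b ∷ S)    p φ s (suc i) i∈S  =
  constraintsOf-elim S (p ∘ suc) φ (AllP.++⁻ʳ (if b then p zero else []) s) i i∈S

constraintsOf-intro : ∀ {m n k} (S : Vec Bool m) (p : Fin m → List (Constraint n)) (φ : Vec (Fin k) n) →
  (∀ i → lookup S i ≡ true → Sat φ (p i)) → Sat φ (constraintsOf S p)
constraintsOf-intro []          p φ h = []
constraintsOf-intro (true ∷ S)  p φ h = AllP.++⁺ (h zero refl) (constraintsOf-intro S (p ∘ suc) φ (h ∘ suc))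
constraintsOf-intro (false ∷ S) p φ h = constraintsOf-intro S (p ∘ suc) φ (h ∘ suc)

components : ∀ {n m} → Hypergraph n m → Vec Bool m → ℕ
components {n} H S = classes n (constraintsOf S (edgeConstraints H))

components-pos : ∀ {n m} (H : Hypergraph (suc n) m) S → 1 ≤ components H S
components-pos {n} H S = classes-pos n (constraintsOf S (edgeConstraints H))

inclusion-exclusion : ∀ {n m} (H : Hypergraph n m) k →
  + chromCount H k ≡ sumB m (λ S → sgn S * (+ k) ^ components H S)
inclusion-exclusion {n} {m} H k = begin
    + chromCount H k
      ≡⟨ length-filter (proper? H) (allMaps n k) ⟩
    sumL (allMaps n k) (λ φ → ind (proper? H φ))
      ≡⟨ sumL-cong (allMaps n k) expand ⟩
    sumL (allMaps n k) (λ φ → sumB m (λ S → sgn S * ind (sat? φ (LS S))))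
      ≡⟨ sumL-sumB (allMaps n k) m _ ⟩
    sumB m (λ S → sumL (allMaps n k) (λ φ → sgn S * ind (sat? φ (LS S))))
      ≡⟨ sumB-cong m (λ S → sumL-*ˡ (allMaps n k) (sgn S) _) ⟩
    sumB m (λ S → sgn S * sumL (allMaps n k) (λ φ → ind (sat? φ (LS S))))
      ≡⟨ sumB-cong m (λ S → cong (sgn S *_) (count-solutions n k (LS S))) ⟩
    sumB m (λ S → sgn S * (+ k) ^ components H S) ∎
  where
  open ≡-Reasoning
  LS : Vec Bool m → List (Constraint n)
  LS S = constraintsOf S (edgeConstraints H)
  mono : Vec (Fin k) n → Fin m → ℤ
  mono φ i = ind (sat? φ (edgeConstraints H i))
  factor : Vec (Fin k) n → Fin m → Bool → ℤ
  factor φ i true  = - mono φ i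
  factor φ i false = + 1
  factor-sign : ∀ φ i b → factor φ i b ≡ sgnᵇ b * select b (mono φ i)
  factor-sign φ i true  = sym (ℤP.-1*i≡-i (mono φ i))
  factor-sign φ i false = refl
  expand : ∀ φ → ind (proper? H φ) ≡ sumB m (λ S → sgn S * ind (sat? φ (LS S)))
  expand φ = begin
      ind (proper? H φ)
        ≡⟨ proper-ind H φ ⟩
      prodF m (λ i → + 1 + - mono φ i)
        ≡⟨ prodF-cong m (λ i → ℤP.+-comm (+ 1) (- mono φ i)) ⟩
      prodF m (λ i → factor φ i true + factor φ i false)
        ≡⟨ sym (expand-product m (factor φ)) ⟩
      sumB m (λ S → prodF m (λ i → factor φ i (lookup S i)))
        ≡⟨ sumB-cong m (λ S → trans (prodF-cong m (λ i → factor-sign φ i (lookup S i))) (prodF-* m _ _)) ⟩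
      sumB m (λ S → sgn S * prodF m (λ i → select (lookup S i) (mono φ i)))
        ≡⟨ sumB-cong m (λ S → cong (sgn S *_) (constraintsOf-ind S (edgeConstraints H) φ)) ⟩
      sumB m (λ S → sgn S * ind (sat? φ (LS S))) ∎

module _ {n m : ℕ} {Ed : Fin m → Subset n} where

  chain-const : ∀ {k} {P : Fin m → Set} (φ : Vec (Fin k) n) →
    (∀ i → P i → ∀ {x y} → x ∈ Ed i → y ∈ Ed i → lookup φ x ≡ lookup φ y) →
    ∀ {v w} → Chain Ed P v w → lookup φ v ≡ lookup φ w
  chain-const φ h (single i p v∈ w∈)   = h i p v∈ w∈
  chain-const φ h (step i p v∈ u∈ c) = trans (h i p v∈ u∈) (chain-const φ h c)

  chain-mono : ∀ {P P′ : Fin m → Set} → (∀ i → P i → P′ i) → ∀ {v w} → Chain Ed P v w → Chain Ed P′ v w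
  chain-mono f (single i p v∈ w∈)   = single i (f i p) v∈ w∈
  chain-mono f (step i p v∈ u∈ c) = step i (f i p) v∈ u∈ (chain-mono f c)

  extend : ∀ {P : Fin m → Set} {v x y} i → Chain Ed P v x → P i → x ∈ Ed i → y ∈ Ed i → Chain Ed P v y
  extend i (single j pj v∈ x∈)   pi x∈′ y∈ = step j pj v∈ x∈ (single i pi x∈′ y∈)
  extend i (step j pj v∈ u∈ c) pi x∈′ y∈ = step j pj v∈ u∈ (extend i c pi x∈′ y∈)

  first-edge : ∀ {P : Fin m → Set} {v w} → Chain Ed P v w → Chain Ed P v v
  first-edge (single i p v∈ _)   = single i p v∈ v∈
  first-edge (step i p v∈ _ _) = single i p v∈ v∈

-- Reachability is not decidable a priori, but when refuting a statement we
-- may assume it is, for finitely many targets at once.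
¬¬-fin : ∀ n {P : Fin n → Set} → (∀ x → ¬ ¬ P x) → ¬ ¬ (∀ x → P x)
¬¬-fin zero    h k = k (λ ())
¬¬-fin (suc n) h k = h zero (λ p₀ → ¬¬-fin n (h ∘ suc) (λ rest → k (λ { zero → p₀ ; (suc x) → rest x })))

bit : {A : Set} → Dec A → Fin 2
bit (yes _) = suc zero
bit (no _)  = zero

bit-⇔ : {A B : Set} (d : Dec A) (e : Dec B) → (A → B) → (B → A) → bit d ≡ bit e
bit-⇔ (yes _) (yes _) f g = refl
bit-⇔ (yes a) (no ¬b) f g = ⊥-elim (¬b (f a))
bit-⇔ (no ¬a) (yes b) f g = ⊥-elim (¬a (g b))
bit-⇔ (no _)  (no _)  f g = refl

InSubset : ∀ {m} → Vec Bool m → Fin m → Set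
InSubset S j = lookup S j ≡ true

OnlyConstantSolutions : ∀ {n m} → Hypergraph n m → Vec Bool m → Set
OnlyConstantSolutions {n} H S = ∀ (φ : Vec (Fin 2) n) →
  Sat φ (constraintsOf S (edgeConstraints H)) → ∀ v w → lookup φ v ≡ lookup φ w

-- Then any two distinct vertices are (not not) joined by a chain in S:
-- otherwise colour the vertices reachable from v by 1 and the rest by 0.
reachable : ∀ {n m} (H : Hypergraph n m) (S : Vec Bool m) → OnlyConstantSolutions H S →
  ∀ v w → w ≢ v → ¬ ¬ Chain (E H) (InSubset S) v w
reachable {n} H S constant v w w≢v no-chain =
  ¬¬-fin n (λ x → ¬¬-excluded-middle {A = Chain (E H) (InSubset S) v x}) refute
  where
  refute : (∀ x → Dec (Chain (E H) (InSubset S) v x)) → ⊥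
  refute chain? = contradiction
    where
    Reached : Fin n → Set
    Reached x = x ≡ v ⊎ Chain (E H) (InSubset S) v x
    reached? : ∀ x → Dec (Reached x)
    reached? x = (x ≟ v) ⊎-dec chain? x
    closed : ∀ i → InSubset S i → ∀ {x y} → x ∈ E H i → y ∈ E H i → Reached x → Reached y
    closed i i∈S x∈ y∈ (inj₁ refl) = inj₂ (single i i∈S x∈ y∈)
    closed i i∈S x∈ y∈ (inj₂ c)    = inj₂ (extend i c i∈S x∈ y∈)
    φ : Vec (Fin 2) n
    φ = tabulate (bit ∘ reached?)
    φ-mono : ∀ i → InSubset S i → ∀ w′ → w′ ∈ E H i → lookup φ (anchor H i) ≡ lookup φ w′
    φ-mono i i∈S w′ w′∈ = begin
      lookup φ (anchor H i)       ≡⟨ lookup∘tabulate _ (anchor H i) ⟩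
      bit (reached? (anchor H i)) ≡⟨ bit-⇔ (reached? _) (reached? w′) (closed i i∈S (anchor∈ H i) w′∈)
                                                                       (closed i i∈S w′∈ (anchor∈ H i)) ⟩
      bit (reached? w′)           ≡⟨ sym (lookup∘tabulate _ w′) ⟩
      lookup φ w′                 ∎
      where open ≡-Reasoning
    φ-sat : Sat φ (constraintsOf S (edgeConstraints H))
    φ-sat = constraintsOf-intro S (edgeConstraints H) φ (λ i i∈S → mono-intro H φ i (φ-mono i i∈S))
    same-bit : bit (reached? v) ≡ bit (reached? w)
    same-bit = trans (sym (lookup∘tabulate _ v)) (trans (constant φ φ-sat v w) (lookup∘tabulate _ w))
    contradiction : ⊥
    contradiction with reached? v | reached? w | same-bit
    ... | _     | yes (inj₁ w≡v) | _ = w≢v w≡v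
    ... | _     | yes (inj₂ c)   | _ = no-chain c
    ... | yes _ | no _           | ()
    ... | no ¬r | no _           | _ = ¬r (inj₁ refl)

connects : ∀ {n m} (H : Hypergraph (suc (suc n)) m) (S : Vec Bool m) → OnlyConstantSolutions H S →
  ¬ ¬ ConnectedOn (E H) (InSubset S)
connects {n} H S constant = ¬¬-fin _ (λ v → ¬¬-fin _ (chain v))
  where
  other : Fin (suc (suc n)) → Fin (suc (suc n))
  other zero    = suc zero
  other (suc _) = zero
  other≢ : ∀ v → other v ≢ v
  other≢ zero    ()
  other≢ (suc v) ()
  chain : ∀ v w → ¬ ¬ Chain (E H) (InSubset S) v w
  chain v w with w ≟ v
  ... | no w≢v  = reachable H S constant v w w≢v
  ... | yes refl = λ no-loop → reachable H S constant v (other v) (other≢ v) (no-loop ∘ first-edge)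

contains-bridges : ∀ {n m} (H : Hypergraph (suc n) m) (e₀ : Fin m) → ¬ IsBridge H e₀ →
  (S : Vec Bool m) → OnlyConstantSolutions H S → ∀ b → IsBridge H b → InSubset S b
contains-bridges H e₀ e₀-not-bridge S constant b b-bridge with lookup S b in b-in-S
... | true  = refl
contains-bridges {zero} H e₀ e₀-not-bridge S constant b b-bridge | false =
  -- One vertex: the edge e₀ ≠ b alone connects H - b.
  ⊥-elim (b-bridge (λ { zero zero → single e₀ e₀≢b (only-vertex∈e₀ zero) (only-vertex∈e₀ zero) }))
  where
  e₀≢b : e₀ ≢ b
  e₀≢b refl = e₀-not-bridge b-bridge
  only-vertex∈e₀ : ∀ v → v ∈ E H e₀
  only-vertex∈e₀ zero with anchor H e₀ | anchor∈ H e₀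
  ... | zero | v∈ = v∈
contains-bridges {suc n} H e₀ e₀-not-bridge S constant b b-bridge | false =
  -- S connects H and avoids b, so H - b is connected.
  ⊥-elim (connects H S constant (λ S-connects → b-bridge (λ v w → chain-mono avoids-b (S-connects v w))))
  where
  avoids-b : ∀ j → InSubset S j → j ≢ b
  avoids-b j j∈S refl with trans (sym j∈S) b-in-S
  ... | ()

-- s·K^c = lowPart c s K + K²·highPoly c s (K).
lowPart : ℕ → ℤ → ℤ → ℤ
lowPart zero          s K = s
lowPart (suc zero)    s K = s * K
lowPart (suc (suc j)) s K = + 0

highPoly : ℕ → ℤ → List ℤ
highPoly (suc (suc j)) s = monomial s j
highPoly _             s = []

split-low : ∀ c s K → s * K ^ c ≡ lowPart c s K + K * K * evalPoly (highPoly c s) K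
split-low zero s K = degree0 s K
  where
  degree0 : ∀ s K → s * + 1 ≡ s + K * K * + 0
  degree0 = solve-∀
split-low (suc zero) s K = degree1 s K
  where
  degree1 : ∀ s K → s * (K * + 1) ≡ s * K + K * K * + 0
  degree1 = solve-∀
split-low (suc (suc j)) s K =
  trans (degree≥2 s K (K ^ j)) (cong (λ t → + 0 + K * K * t) (sym (eval-monomial s j K)))
  where
  degree≥2 : ∀ s K y → s * (K * (K * y)) ≡ + 0 + K * K * (s * y)
  degree≥2 = solve-∀

lowPart-negate : ∀ {c c′} s K → 1 ≤ c → 1 ≤ c′ → (c ≤ 1 → c′ ≤ 1) → (c′ ≤ 1 → c ≤ 1) →
  lowPart c′ (- s) K ≡ - lowPart c s K
lowPart-negate {1}           {1}           s K _ _ _ _ = sym (ℤP.neg-distribˡ-* s K)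
lowPart-negate {1}           {suc (suc _)} s K _ _ to _ with to ℕP.≤-refl
... | s≤s ()
lowPart-negate {suc (suc _)} {1}           s K _ _ _ from with from ℕP.≤-refl
... | s≤s ()
lowPart-negate {suc (suc _)} {suc (suc _)} s K _ _ _ _ = refl

module Cancellation {n′ m : ℕ} (H : Hypergraph (suc n′) m) (e₀ : Fin m) (e₀-not-bridge : ¬ IsBridge H e₀)
                    (bridges-connect : ConnectedOn (E H) (IsBridge H)) where

  ContainsBridges : Vec Bool m → Set
  ContainsBridges S = ∀ b → IsBridge H b → InSubset S b

  -- Since the bridges connect H, so does any S containing them.
  bridges⇒connected : ∀ S → ContainsBridges S → components H S ≤ 1
  bridges⇒connected S bridges⊆S with 2 ≤? components H S
  ... | no ≱2 = ℕP.≤-pred (ℕP.≰⇒> ≱2)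
  ... | yes ≥2 with two-classes⇒nonconstant _ (constraintsOf S (edgeConstraints H)) ≥2
  ...   | φ , s , v , w , φv≢φw = ⊥-elim (φv≢φw (chain-const φ mono-on-bridges (bridges-connect v w)))
    where
    mono-on-bridges : ∀ i → IsBridge H i → ∀ {x y} → x ∈ E H i → y ∈ E H i → lookup φ x ≡ lookup φ y
    mono-on-bridges i i-bridge =
      mono-eq H φ i (constraintsOf-elim S (edgeConstraints H) φ s i (bridges⊆S i i-bridge))

  connected⇒bridges : ∀ S → components H S ≤ 1 → ContainsBridges S
  connected⇒bridges S c≤1 =
    contains-bridges H e₀ e₀-not-bridge S (λ φ → one-class⇒constant _ (constraintsOf S (edgeConstraints H)) c≤1 φ)

  toggle-keeps-bridges : ∀ S → ContainsBridges S → ContainsBridges (toggle e₀ S)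
  toggle-keeps-bridges S bridges⊆S b b-bridge =
    trans (lookup-toggle e₀ b S (λ { refl → e₀-not-bridge b-bridge })) (bridges⊆S b b-bridge)

  toggle-reflects-bridges : ∀ S → ContainsBridges (toggle e₀ S) → ContainsBridges S
  toggle-reflects-bridges S bridges⊆S′ b b-bridge =
    trans (sym (lookup-toggle e₀ b S (λ { refl → e₀-not-bridge b-bridge }))) (bridges⊆S′ b b-bridge)

  low : ℤ → Vec Bool m → ℤ
  low K S = lowPart (components H S) (sgn S) K

  toggle-connected : ∀ S → components H S ≤ 1 → components H (toggle e₀ S) ≤ 1
  toggle-connected S c≤1 = bridges⇒connected (toggle e₀ S) (toggle-keeps-bridges S (connected⇒bridges S c≤1))

  toggle-connected⁻ : ∀ S → components H (toggle e₀ S) ≤ 1 → components H S ≤ 1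
  toggle-connected⁻ S c≤1 = bridges⇒connected S (toggle-reflects-bridges S (connected⇒bridges (toggle e₀ S) c≤1))

  low-odd : ∀ K S → low K (toggle e₀ S) ≡ - low K S
  low-odd K S = begin
    lowPart (components H S′) (sgn S′) K   ≡⟨ cong (λ s → lowPart (components H S′) s K) (sgn-toggle e₀ S) ⟩
    lowPart (components H S′) (- sgn S) K  ≡⟨ lowPart-negate (sgn S) K (components-pos H S) (components-pos H S′)
                                                             (toggle-connected S) (toggle-connected⁻ S) ⟩
    - lowPart (components H S) (sgn S) K   ∎
    where
    open ≡-Reasoning
    S′ = toggle e₀ S

  square-divides : SquareDividesChrom H
  square-divides = Q , λ k → let K = + suc k in begin
      + chromCount H (suc k)
        ≡⟨ inclusion-exclusion H (suc k) ⟩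
      sumB m (λ S → sgn S * K ^ components H S)
        ≡⟨ sumB-cong m (λ S → split-low (components H S) (sgn S) K) ⟩
      sumB m (λ S → low K S + K * K * high K S)
        ≡⟨ sumB-+ m (low K) _ ⟩
      sumB m (low K) + sumB m (λ S → K * K * high K S)
        ≡⟨ cong₂ _+_ (sumB-toggle m e₀ (low K) (low-odd K)) (sumB-*ˡ m (K * K) (high K)) ⟩
      + 0 + K * K * sumB m (high K)
        ≡⟨ ℤP.+-identityˡ _ ⟩
      K * K * sumB m (high K)
        ≡⟨ cong (K * K *_) (sym (eval-sumPolyB m _ K)) ⟩
      K * K * evalPoly Q K ∎
    where
    open ≡-Reasoning
    Q : List ℤ
    Q = sumPolyB m (λ S → highPoly (components H S) (sgn S))
    high : ℤ → Vec Bool m → ℤ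
    high K S = evalPoly (highPoly (components H S) (sgn S)) K

-- Theorem 3.  Without vertices there could be no (nonempty) edge e₀.  The
-- connectedness of H is implied by the bridges connecting it, and not used.
theorem3 : ∀ {n m : ℕ} (H : Hypergraph n m) → Connected H
    → (∃ λ (i : Fin m) → ¬ IsBridge H i)
    → ConnectedOn (E H) (IsBridge H)
    → SquareDividesChrom H
theorem3 {zero} H _ (e₀ , _) _ with proj₁ (nonempty H e₀)
... | ()
theorem3 {suc n} H _ (e₀ , e₀-not-bridge) bridges-connect =
  Cancellation.square-divides H e₀ e₀-not-bridge bridges-connect
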